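{- Let $\mathcal{A}$ be a finite separating union-closed family of sets whose universe $U(\mathcal{A})=\bigcup_{A\in\mathcal{A}}A$ has $m\geq 1$ elements, and suppose $|\mathcal{A}|\leq 2m$. Then there is an element $x\in U(\mathcal{A})$ that is contained in at least $\tfrac{1}{2}|\mathcal{A}|$ member-sets of $\mathcal{A}$.
   Context: A family $\mathcal{A}$ of sets is union-closed if $A\cup B\in\mathcal{A}$ for all $A,B\in\mathcal{A}$. It is separating if for any two distinct elements $x,y\in U(\mathcal{A})$ there is a member-set $A\in\mathcal{A}$ containing exactly one of $x,y$. -}

module Defs where

open import Data.Nat using (ℕ)
open import Data.Fin using (Fin)
open import Data.Fin.Subset using (Subset; _∪_; _∈_; _∉_; ⋃; ∣_∣)
open import Data.Fin.Subset.Properties using (_∈?_)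
open import Data.List using (List; length; filter)
open import Data.List.Membership.Propositional using () renaming (_∈_ to _∈ₗ_)
open import Data.List.Relation.Unary.Unique.Propositional using (Unique)
open import Data.Product using (∃; _×_)
open import Data.Sum using (_⊎_)
open import Relation.Binary.PropositionalEquality using (_≢_)

record Family (n : ℕ) : Set where
  constructor family
  field
    members : List (Subset n)
    distinct : Unique members
open Family public

size : ∀ {n} → Family n → ℕ
size 𝒜 = length (members 𝒜)

universe : ∀ {n} → Family n → Subset n
universe 𝒜 = ⋃ (members 𝒜)

UnionClosed : ∀ {n} → Family n → Set
UnionClosed 𝒜 = ∀ A B → A ∈ₗ members 𝒜 → B ∈ₗ members 𝒜 → (A ∪ B) ∈ₗ members 𝒜

Separating : ∀ {n} → Family n → Set
Separating 𝒜 = ∀ x y → x ∈ universe 𝒜 → y ∈ universe 𝒜 → x ≢ y →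
  ∃ λ A → A ∈ₗ members 𝒜 × ((x ∈ A × y ∉ A) ⊎ (y ∈ A × x ∉ A))

degree : ∀ {n} → Family n → Fin n → ℕ
degree 𝒜 x = length (filter (x ∈?_) (members 𝒜))

-- For y ∈ U(𝒜) let B y (maxAvoiding y) be the union of the member-sets avoiding y: by union-closedness it is
-- the largest member avoiding y, or ∅. Pick x ∈ U(𝒜) with ∣ B x ∣ minimal. For y ≠ x the set
-- B y contains x: otherwise separation yields a member containing y but not x, which lies in
-- B x, and then B y ⊊ B x. Separation also makes y ↦ B y injective and keeps every B y away
-- from U(𝒜), so x ↦ U(𝒜), y ↦ B y (y ≠ x) injects U(𝒜) into the members containing x. Hence
-- x has degree at least ∣ U(𝒜) ∣ ≥ ½ ∣ 𝒜 ∣.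
module Submission where

open import Defs
open import Data.Nat using (ℕ; _+_; _*_; _≤_; _<_; z≤n; s≤s)
open import Data.Nat.Properties using (≤-trans; <⇒≱; *-monoʳ-≤; module ≤-Reasoning)
open import Data.Fin using (Fin; suc; _≟_)
open import Data.Fin.Properties using (suc-injective)
open import Data.Fin.Subset using (Subset; _∈_; _∉_; _⊆_; _∪_; ⋃; ⊥; ∣_∣; Nonempty; inside; outside)
open import Data.Fin.Subset.Properties
  using (_∈?_; ∉⊥; x∈p∪q⁻; p⊆p∪q; q⊆p∪q; ∪-identityʳ; p⊂q⇒∣p∣<∣q∣; nonempty?; Empty-unique; ∣⊥∣≡0)
open import Data.Vec using ([]; _∷_; here; there)
open import Data.List using (List; []; _∷_; length; filter; allFin)
open import Data.List.Properties using (length-removeAt′)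
open import Data.List.Extrema.Nat using (argmin; argmin-all; f[argmin]≤f[xs])
open import Data.List.Membership.Propositional using () renaming (_∈_ to _∈ₗ_)
open import Data.List.Membership.Propositional.Properties using (∈-filter⁺; ∈-filter⁻; ∈-allFin)
open import Data.List.Relation.Unary.Any using (_─_) renaming (here to hereₗ; there to thereₗ)
open import Data.List.Relation.Unary.All using () renaming (lookup to lookupₗ)
open import Data.List.Relation.Unary.All.Properties using (all-filter)
open import Data.List.Relation.Binary.Subset.Propositional using () renaming (_⊆_ to _⊆ₗ_)
open import Data.Product using (∃; _×_; _,_; proj₁; proj₂)
open import Data.Sum using (_⊎_; inj₁; inj₂)
open import Relation.Nullary using (yes; no; ¬?; contradiction)
open import Relation.Binary.PropositionalEquality using (_≡_; _≢_; refl; sym; trans; cong; subst)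

∈-─⁺ : ∀ {A : Set} {y z : A} {ys : List A} (y∈ys : y ∈ₗ ys) → z ∈ₗ ys → z ≢ y → z ∈ₗ (ys ─ y∈ys)
∈-─⁺ (hereₗ refl) (hereₗ refl)  z≢y = contradiction refl z≢y
∈-─⁺ (hereₗ refl) (thereₗ z∈ys) _   = z∈ys
∈-─⁺ (thereₗ _)   (hereₗ refl)  _   = hereₗ refl
∈-─⁺ (thereₗ y∈ys) (thereₗ z∈ys) z≢y = thereₗ (∈-─⁺ y∈ys z∈ys z≢y)

InjectiveOn : ∀ {n} {B : Set} → Subset n → (Fin n → B) → Set
InjectiveOn p f = ∀ {x y} → x ∈ p → y ∈ p → f x ≡ f y → x ≡ y

InjectiveOn-∷ : ∀ {n} {B : Set} {s} {p : Subset n} {f : Fin (1 + n) → B} →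
  InjectiveOn (s ∷ p) f → InjectiveOn p (λ x → f (suc x))
InjectiveOn-∷ inj x∈p y∈p e = suc-injective (inj (there x∈p) (there y∈p) e)

injectiveOn⇒∣p∣≤length : ∀ {n} {B : Set} (p : Subset n) (f : Fin n → B) (ys : List B) →
  InjectiveOn p f → (∀ {x} → x ∈ p → f x ∈ₗ ys) → ∣ p ∣ ≤ length ys
injectiveOn⇒∣p∣≤length []            f ys inj into = z≤n
injectiveOn⇒∣p∣≤length (outside ∷ p) f ys inj into =
  injectiveOn⇒∣p∣≤length p (λ x → f (suc x)) ys (InjectiveOn-∷ inj) (λ x∈p → into (there x∈p))
injectiveOn⇒∣p∣≤length (inside ∷ p)  f ys inj into = begin
  1 + ∣ p ∣       ≤⟨ s≤s (injectiveOn⇒∣p∣≤length p (λ x → f (suc x)) ys′ (InjectiveOn-∷ inj) into′) ⟩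
  1 + length ys′  ≡⟨ length-removeAt′ ys _ ⟨
  length ys       ∎
  where
  open ≤-Reasoning
  ys′ : List _
  ys′ = ys ─ into here
  into′ : ∀ {x} → x ∈ p → f (suc x) ∈ₗ ys′
  into′ x∈p = ∈-─⁺ (into here) (into (there x∈p)) (λ e → contradiction (inj (there x∈p) here e) λ ())

1≤∣p∣⇒Nonempty : ∀ {n} {p : Subset n} → 1 ≤ ∣ p ∣ → Nonempty p
1≤∣p∣⇒Nonempty {n} {p} 1≤∣p∣ with nonempty? p
... | yes p≢∅ = p≢∅
... | no  p-empty with () ← subst (1 ≤_) (∣⊥∣≡0 n) (subst (λ q → 1 ≤ ∣ q ∣) (Empty-unique p-empty) 1≤∣p∣)

minimiser : ∀ {n} (g : Fin n → ℕ) {p : Subset n} → Nonempty p →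
  ∃ λ x → x ∈ p × (∀ {y} → y ∈ p → g x ≤ g y)
minimiser {n} g {p} (x₀ , x₀∈p) =
  argmin g x₀ xs , argmin-all g x₀∈p (all-filter (_∈? p) (allFin n)) ,
  λ y∈p → lookupₗ (f[argmin]≤f[xs] x₀ xs) (∈-filter⁺ (_∈? p) (∈-allFin _) y∈p)
  where
  xs : List (Fin n)
  xs = filter (_∈? p) (allFin n)

⊆-⋃ : ∀ {n} {C : Subset n} {cs : List (Subset n)} → C ∈ₗ cs → C ⊆ ⋃ cs
⊆-⋃ {cs = C ∷ cs} (hereₗ refl) = p⊆p∪q (⋃ cs)
⊆-⋃ {cs = D ∷ cs} (thereₗ C∈cs) x∈C = q⊆p∪q D (⋃ cs) (⊆-⋃ C∈cs x∈C)

∈-⋃⁻ : ∀ {n} {x : Fin n} (cs : List (Subset n)) → x ∈ ⋃ cs → ∃ λ C → C ∈ₗ cs × x ∈ C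
∈-⋃⁻ []       x∈∅ = contradiction x∈∅ ∉⊥
∈-⋃⁻ (C ∷ cs) x∈⋃ with x∈p∪q⁻ C (⋃ cs) x∈⋃
... | inj₁ x∈C  = C , hereₗ refl , x∈C
... | inj₂ x∈⋃cs with ∈-⋃⁻ cs x∈⋃cs
...   | D , D∈cs , x∈D = D , thereₗ D∈cs , x∈D

⋃-closed : ∀ {n} (𝒜 : Family n) → UnionClosed 𝒜 → {cs : List (Subset n)} → cs ⊆ₗ members 𝒜 →
  ⋃ cs ≡ ⊥ ⊎ ⋃ cs ∈ₗ members 𝒜
⋃-closed 𝒜 closed {[]}     cs⊆𝒜 = inj₁ refl
⋃-closed 𝒜 closed {C ∷ cs} cs⊆𝒜 with ⋃-closed 𝒜 closed (λ D∈cs → cs⊆𝒜 (thereₗ D∈cs))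
... | inj₁ ⋃cs≡∅ = inj₂ (subst (_∈ₗ members 𝒜) (sym (trans (cong (C ∪_) ⋃cs≡∅) (∪-identityʳ C)))
                          (cs⊆𝒜 (hereₗ refl)))
... | inj₂ ⋃cs∈𝒜 = inj₂ (closed C (⋃ cs) (cs⊆𝒜 (hereₗ refl)) ⋃cs∈𝒜)

∈⋃⇒⋃∈ : ∀ {n} (𝒜 : Family n) → UnionClosed 𝒜 → {cs : List (Subset n)} → cs ⊆ₗ members 𝒜 →
  {x : Fin n} → x ∈ ⋃ cs → ⋃ cs ∈ₗ members 𝒜
∈⋃⇒⋃∈ 𝒜 closed cs⊆𝒜 x∈⋃ with ⋃-closed 𝒜 closed cs⊆𝒜
... | inj₁ ⋃cs≡∅ = contradiction (subst (_ ∈_) ⋃cs≡∅ x∈⋃) ∉⊥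
... | inj₂ ⋃cs∈𝒜 = ⋃cs∈𝒜

module _ {n} (𝒜 : Family n) where

  avoiding : Fin n → List (Subset n)
  avoiding y = filter (λ A → ¬? (y ∈? A)) (members 𝒜)

  ∈-avoiding⁻ : ∀ {A y} → A ∈ₗ avoiding y → A ∈ₗ members 𝒜 × y ∉ A
  ∈-avoiding⁻ {y = y} = ∈-filter⁻ (λ A → ¬? (y ∈? A)) {xs = members 𝒜}

  maxAvoiding : Fin n → Subset n
  maxAvoiding y = ⋃ (avoiding y)

  ∉-maxAvoiding : ∀ y → y ∉ maxAvoiding y
  ∉-maxAvoiding y y∈B with ∈-⋃⁻ (avoiding y) y∈B
  ... | C , C∈avoiding , y∈C = proj₂ (∈-avoiding⁻ C∈avoiding) y∈C

  ⊆-maxAvoiding : ∀ {A y} → A ∈ₗ members 𝒜 → y ∉ A → A ⊆ maxAvoiding y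
  ⊆-maxAvoiding {y = y} A∈𝒜 y∉A = ⊆-⋃ (∈-filter⁺ (λ A → ¬? (y ∈? A)) A∈𝒜 y∉A)

  maxAvoiding-mono : ∀ {x y} → x ∉ maxAvoiding y → maxAvoiding y ⊆ maxAvoiding x
  maxAvoiding-mono {x} {y} x∉B z∈B with ∈-⋃⁻ (avoiding y) z∈B
  ... | C , C∈avoiding , z∈C with ∈-avoiding⁻ C∈avoiding
  ...   | C∈𝒜 , y∉C = ⊆-maxAvoiding C∈𝒜 (λ x∈C → x∉B (⊆-maxAvoiding C∈𝒜 y∉C x∈C)) z∈C

  maxAvoiding-∈ : UnionClosed 𝒜 → ∀ {x y} → x ∈ maxAvoiding y → maxAvoiding y ∈ₗ members 𝒜
  maxAvoiding-∈ closed = ∈⋃⇒⋃∈ 𝒜 closed (λ A∈avoiding → proj₁ (∈-avoiding⁻ A∈avoiding))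

  universe-∈ : UnionClosed 𝒜 → ∀ {x} → x ∈ universe 𝒜 → universe 𝒜 ∈ₗ members 𝒜
  universe-∈ closed = ∈⋃⇒⋃∈ 𝒜 closed (λ A∈𝒜 → A∈𝒜)

  maxAvoiding≢universe : ∀ {y} → y ∈ universe 𝒜 → maxAvoiding y ≢ universe 𝒜
  maxAvoiding≢universe {y} y∈U B≡U = ∉-maxAvoiding y (subst (y ∈_) (sym B≡U) y∈U)

  maxAvoiding-injective : Separating 𝒜 → InjectiveOn (universe 𝒜) maxAvoiding
  maxAvoiding-injective separating {x} {y} x∈U y∈U Bx≡By with x ≟ y
  ... | yes x≡y = x≡y
  ... | no  x≢y with separating x y x∈U y∈U x≢y
  ...   | A , A∈𝒜 , inj₁ (x∈A , y∉A) =
          contradiction (subst (x ∈_) (sym Bx≡By) (⊆-maxAvoiding A∈𝒜 y∉A x∈A)) (∉-maxAvoiding x)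
  ...   | A , A∈𝒜 , inj₂ (y∈A , x∉A) =
          contradiction (subst (y ∈_) Bx≡By (⊆-maxAvoiding A∈𝒜 x∉A y∈A)) (∉-maxAvoiding y)

  ∉-maxAvoiding⇒∣maxAvoiding∣< : Separating 𝒜 → ∀ {x y} → x ∈ universe 𝒜 → y ∈ universe 𝒜 →
    x ≢ y → x ∉ maxAvoiding y → ∣ maxAvoiding y ∣ < ∣ maxAvoiding x ∣
  ∉-maxAvoiding⇒∣maxAvoiding∣< separating {x} {y} x∈U y∈U x≢y x∉By
    with separating x y x∈U y∈U x≢y
  ... | A , A∈𝒜 , inj₁ (x∈A , y∉A) = contradiction (⊆-maxAvoiding A∈𝒜 y∉A x∈A) x∉By
  ... | A , A∈𝒜 , inj₂ (y∈A , x∉A) =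
        p⊂q⇒∣p∣<∣q∣ (maxAvoiding-mono x∉By , y , ⊆-maxAvoiding A∈𝒜 x∉A y∈A , ∉-maxAvoiding y)

  ∈-maxAvoiding-of-minimiser : Separating 𝒜 → ∀ {x y} → x ∈ universe 𝒜 → y ∈ universe 𝒜 →
    x ≢ y → ∣ maxAvoiding x ∣ ≤ ∣ maxAvoiding y ∣ → x ∈ maxAvoiding y
  ∈-maxAvoiding-of-minimiser separating {x} {y} x∈U y∈U x≢y minimal with x ∈? maxAvoiding y
  ... | yes x∈By = x∈By
  ... | no  x∉By =
        contradiction minimal (<⇒≱ (∉-maxAvoiding⇒∣maxAvoiding∣< separating x∈U y∈U x≢y x∉By))

  -- U(𝒜) stands in for B x, which need not contain x.
  memberThrough : Fin n → Fin n → Subset n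
  memberThrough x y with y ≟ x
  ... | yes _ = universe 𝒜
  ... | no  _ = maxAvoiding y

  ∣universe∣≤degree : UnionClosed 𝒜 → Separating 𝒜 → ∀ {x} → x ∈ universe 𝒜 →
    (∀ {y} → y ∈ universe 𝒜 → ∣ maxAvoiding x ∣ ≤ ∣ maxAvoiding y ∣) →
    ∣ universe 𝒜 ∣ ≤ degree 𝒜 x
  ∣universe∣≤degree closed separating {x} x∈U minimal =
    injectiveOn⇒∣p∣≤length (universe 𝒜) (memberThrough x) (filter (x ∈?_) (members 𝒜))
      injective contains-x
    where
    injective : InjectiveOn (universe 𝒜) (memberThrough x)
    injective {y} {z} y∈U z∈U eq with y ≟ x | z ≟ x
    ... | yes y≡x | yes z≡x = trans y≡x (sym z≡x)
    ... | yes _   | no  _   = contradiction (sym eq) (maxAvoiding≢universe z∈U)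
    ... | no  _   | yes _   = contradiction eq (maxAvoiding≢universe y∈U)
    ... | no  _   | no  _   = maxAvoiding-injective separating y∈U z∈U eq

    contains-x : ∀ {y} → y ∈ universe 𝒜 → memberThrough x y ∈ₗ filter (x ∈?_) (members 𝒜)
    contains-x {y} y∈U with y ≟ x
    ... | yes _   = ∈-filter⁺ (x ∈?_) (universe-∈ closed x∈U) x∈U
    ... | no  y≢x = ∈-filter⁺ (x ∈?_) (maxAvoiding-∈ closed x∈By) x∈By
      where
      x∈By : x ∈ maxAvoiding y
      x∈By = ∈-maxAvoiding-of-minimiser separating x∈U y∈U (λ x≡y → y≢x (sym x≡y)) (minimal y∈U)

mainTheorem2 : ∀ (n : ℕ) (𝒜 : Family n) → UnionClosed 𝒜 → Separating 𝒜 →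
    1 ≤ ∣ universe 𝒜 ∣ → size 𝒜 ≤ 2 * ∣ universe 𝒜 ∣ →
    ∃ λ x → x ∈ universe 𝒜 × size 𝒜 ≤ 2 * degree 𝒜 x
mainTheorem2 n 𝒜 closed separating 1≤∣U∣ size≤2∣U∣
  with x , x∈U , minimal ← minimiser (λ y → ∣ maxAvoiding 𝒜 y ∣) (1≤∣p∣⇒Nonempty 1≤∣U∣) =
  x , x∈U , ≤-trans size≤2∣U∣ (*-monoʳ-≤ 2 (∣universe∣≤degree 𝒜 closed separating x∈U minimal))
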